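{- Let $\Sigma$ be a totally ordered alphabet, $w \ge 1$ an integer, $E \subseteq \Sigma^w$ any set of strings of length $w$, and $E' = E \cup \{\mathtt{\#}, \mathtt{\$}^w\}$, where $\mathtt{\#}$ and $\mathtt{\$}$ are special symbols not in $\Sigma$ that are lexicographically smaller than every symbol of $\Sigma$. Let $T[0..n-1]$ be a string over $\Sigma$. Let $D$ be the maximal set of strings $d$ such that: $d$ is a substring of $\mathtt{\#}\,T\,\mathtt{\$}^w$; exactly one proper prefix of $d$ is in $E'$; exactly one proper suffix of $d$ is in $E'$; and no other substring of $d$ is in $E'$. Let $S$ be the set of all suffixes of elements of $D$ that have length greater than $w$. For each suffix $x$ of $\mathtt{\#}\,T\,\mathtt{\$}^w$ with $|x|>w$ let $f(x)$ denote the unique prefix of $x$ that belongs to $S$. Let $x$ and $x'$ be suffixes of $\mathtt{\#}\,T\,\mathtt{\$}^w$ with $|x|, |x'| > w$. Then $f(x) \prec f(x')$ implies $x \prec x'$.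
   Context: $\prec$ denotes strict lexicographic precedence on strings over $\Sigma \cup \{\mathtt{\#},\mathtt{\$}\}$. It is a fact (proved in the paper) that every suffix $x$ of $\mathtt{\#}\,T\,\mathtt{\$}^w$ with $|x|>w$ has exactly one prefix in $S$, so $f$ is well defined. -}

module Defs where

open import Data.Nat using (ℕ; _<_)
open import Data.List using (List; []; _∷_; _++_; map; replicate; length)
open import Data.Product using (Σ; ∃; ∃₂; _×_; _,_)
open import Data.Sum using (_⊎_)
open import Relation.Binary.PropositionalEquality using (_≡_; _≢_)

data Char (A : Set) : Set where
  hash   : Char A
  dollar : Char A
  sym    : A → Char A

Str : Set → Set
Str A = List (Char A)

Substring : {X : Set} → List X → List X → Set
Substring d s = ∃₂ λ u v → s ≡ u ++ d ++ v

IsPrefix : {X : Set} → List X → List X → Set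
IsPrefix p s = ∃ λ v → s ≡ p ++ v

IsSuffix : {X : Set} → List X → List X → Set
IsSuffix q s = ∃ λ u → s ≡ u ++ q

ProperPrefix : {X : Set} → List X → List X → Set
ProperPrefix p s = ∃ λ v → v ≢ [] × s ≡ p ++ v

ProperSuffix : {X : Set} → List X → List X → Set
ProperSuffix q s = ∃ λ u → u ≢ [] × s ≡ u ++ q

E′ : {A : Set} → ℕ → (List A → Set) → Str A → Set
E′ w E s = (∃ λ e → E e × s ≡ map sym e) ⊎ ((s ≡ hash ∷ []) ⊎ (s ≡ replicate w dollar))

text : {A : Set} → ℕ → List A → Str A
text w T = hash ∷ (map sym T ++ replicate w dollar)

InD : {A : Set} → ℕ → (List A → Set) → List A → Str A → Set
InD w E T d =
  Substring d (text w T)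
  × (∃ λ p → (ProperPrefix p d × E′ w E p)
       × (∀ p′ → ProperPrefix p′ d → E′ w E p′ → p′ ≡ p))
  × (∃ λ q → (ProperSuffix q d × E′ w E q)
       × (∀ q′ → ProperSuffix q′ d → E′ w E q′ → q′ ≡ q))
  -- no other occurrence of an element of E' inside d
  × (∀ u s v → d ≡ u ++ s ++ v → E′ w E s →
       (u ≡ [] × v ≢ []) ⊎ (v ≡ [] × u ≢ []))

InS : {A : Set} → ℕ → (List A → Set) → List A → Str A → Set
InS w E T s = ∃ λ d → InD w E T d × IsSuffix s d × w < length s

-- Comparing f(x) with f(x′) either already separates x from x′ at a
-- position inside f(x), or f(x) is a proper prefix of f(x′).  In the second
-- case f(x) is a prefix of x′ lying in S, so by uniqueness it equals f(x′),
-- which is absurd.  Only the uniqueness of f(x′) is used.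
module Submission where

open import Defs
open import Data.Nat using (ℕ; _≤_; _<_)
open import Data.List using (List; []; _∷_; _++_; length)
open import Data.List.Properties using (++-assoc; ++-identityʳ-unique)
open import Data.List.Relation.Binary.Lex.Core using (halt; this; next)
open import Data.List.Relation.Binary.Lex.Strict using (Lex-<)
open import Data.Product using (_,_)
open import Data.Sum using (_⊎_; inj₁; inj₂)
open import Data.Empty using (⊥-elim)
open import Level using (0ℓ)
open import Relation.Binary.Core using (Rel)
open import Relation.Binary.Structures using (IsStrictTotalOrder)
open import Relation.Binary.PropositionalEquality
  using (_≡_; _≢_; refl; cong; subst₂)
  renaming (sym to ≡-sym)

module _ {X : Set} {_≺_ : Rel X 0ℓ} where

  Lex-<⇒properPrefix⊎Lex-<-++ : ∀ {a b} → Lex-< _≡_ _≺_ a b →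
    ProperPrefix a b ⊎ (∀ u v → Lex-< _≡_ _≺_ (a ++ u) (b ++ v))
  Lex-<⇒properPrefix⊎Lex-<-++ {b = y ∷ ys} halt = inj₁ (y ∷ ys , (λ ()) , refl)
  Lex-<⇒properPrefix⊎Lex-<-++ (this x≺y) = inj₂ λ _ _ → this x≺y
  Lex-<⇒properPrefix⊎Lex-<-++ {a = x ∷ _} (next refl as<bs)
    with Lex-<⇒properPrefix⊎Lex-<-++ as<bs
  ... | inj₁ (r , r≢[] , bs≡as++r) = inj₁ (r , r≢[] , cong (x ∷_) bs≡as++r)
  ... | inj₂ as++<bs++             = inj₂ λ u v → next refl (as++<bs++ u v)

properPrefix⇒≢ : {X : Set} {a b : List X} → ProperPrefix a b → a ≢ b
properPrefix⇒≢ {a = a} (r , r≢[] , b≡a++r) refl = r≢[] (++-identityʳ-unique a b≡a++r)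

properPrefix-isPrefix-trans : {X : Set} {a b c : List X} →
  ProperPrefix a b → IsPrefix b c → IsPrefix a c
properPrefix-isPrefix-trans {a = a} (r , _ , refl) (v , refl) = r ++ v , ++-assoc a r v

lemma4 : {A : Set} (_≺_ : Rel (Char A) 0ℓ) → IsStrictTotalOrder _≡_ _≺_ →
         (∀ a → hash ≺ sym a) → (∀ a → dollar ≺ sym a) →
         (w : ℕ) → 1 ≤ w →
         (E : List A → Set) → (∀ e → E e → length e ≡ w) →
         (T : List A) →
         (x x′ fx fx′ : Str A) →
         IsSuffix x (text w T) → w < length x →
         IsSuffix x′ (text w T) → w < length x′ →
         IsPrefix fx x → InS w E T fx →
         (∀ q → IsPrefix q x → InS w E T q → q ≡ fx) →
         IsPrefix fx′ x′ → InS w E T fx′ →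
         (∀ q → IsPrefix q x′ → InS w E T q → q ≡ fx′) →
         Lex-< _≡_ _≺_ fx fx′ → Lex-< _≡_ _≺_ x x′
lemma4 _≺_ _ _ _ _ _ _ _ _ _ _ fx _ _ _ _ _
       (v , x≡fx++v) fx∈S _ fx′⊑x′@(v′ , x′≡fx′++v′) _ unique-fx′ fx<fx′
  with Lex-<⇒properPrefix⊎Lex-<-++ fx<fx′
... | inj₂ extend = subst₂ (Lex-< _≡_ _≺_) (≡-sym x≡fx++v) (≡-sym x′≡fx′++v′) (extend v v′)
... | inj₁ fx⊏fx′ =
  ⊥-elim (properPrefix⇒≢ fx⊏fx′
           (unique-fx′ fx (properPrefix-isPrefix-trans fx⊏fx′ fx′⊑x′) fx∈S))
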